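{- Fix an integer $k\ge1$, let $S_k:=(0,2,2^2,\dots,2^{2k},0)$, and consider only states $F$ with $S_k\mapsto F$ and not $S_{k+1}\mapsto F$. Let $E=(a_\ell,\dots,a_1,a_0)$ be an embanked state with $h(E)=(h_1,h_2)$ and $s(E)=(s_1,s_2)$, and let $i\in[0,\ell]$ be such that $E[i]$ is weakly embanked. Then $$h(E[i])=\begin{cases}(h_1-1,h_2)& i=0\\ (h_1,h_2+1)& i=1\\ (h_1,h_2)& i\ge2,\end{cases}\qquad s(E[i])=\begin{cases}(s_1-2,s_2)& i=0\\ (s_1,s_2+2)& i=1\\ (s_1,s_2)& i\ge2.\end{cases}$$
   Context: A state is a finite tuple of integers $S=(a_\ell,\dots,a_1,a_0)$, $\ell\ge0$; $a_i$ is the $i$-th index (counted from the right starting at 0). The successor $P(S)$: (Overflow) if $a_\ell$ is odd and all other entries even, $P(S)=(0,a_\ell+1,a_{\ell-1},\dots,a_0)$; (Halt) if all entries even and $a_\ell=a_{\ell-1}=0$, the process halts; (Zero) if all entries even and $(a_\ell,a_{\ell-1})\ne(0,0)$, $P(S)=(0,0,a_\ell+1,a_{\ell-1},\dots,a_1,a_0-1)$; (Halve) if $a_0=-1$, $P(S)=(a_\ell,\dots,a_1)$; (Increment) otherwise, with $i$ the smallest index such that $a_i$ is odd, $P(S)=(a_\ell,\dots,a_{i+2},a_{i+1}+1,a_i,\dots,a_1,a_0-1)$. $S\mapsto T$ means $T=P^j(S)$ for some $j\ge0$. For real $r$, $\langle r\rangle$ is the nearest integer, halves rounded up. For a state $S$: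 $\ell(S)$ = length minus one; $a_i(S)$ its $i$-th entry; $\sigma(S)=+1$ if $\sum_i a_i$ is odd, $-1$ if even; $n(S)$ is the unique integer $0\le n<2^\ell$ with $\langle n/2^i\rangle\equiv a_i\pmod 2$ for $1\le i\le\ell$. A state $E$ is empty if $n(E)=0$, $\sigma(E)=-1$, and the rule applied at $E$ is not Halt. For empty $E$, $N(E)$ is the first empty state $P^j(E)$, $j\ge1$ (if it exists), and $T_E$ is the sequence of rules applied from $E$ to $N(E)$ (or all rules after $E$ if $N(E)$ does not exist). Empty $E$ is embanked if the rules of $T_E$ other than Increment rules are exactly one Zero rule, at the start, and exactly two Halve rules. Empty $E$ is weakly embanked if $T_E$ begins with Zero, contains at least two Halve rules, and all rules before the second Halve rule other than the initial Zero and the first Halve are Increments. For weakly embanked $E$ and $i\in\{1,2\}$, $h_i(E)$ (resp. $s_i(E)$) is the value of $n$ at the state immediately after (resp. before) the $i$-th Halve rule of $T_E$; $h(E)=(h_1(E),h_2(E))$, $s(E)=(s_1(E),s_2(E))$. For $E=(a_\ell,\dots,a_0)$ and $i\in[0,\ell]$, $E[i]:=(a_\ell,\dots,a_{i+1},a_i+2,a_{i-1},\dots,a_0)$. -}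

module Defs where

open import Data.Bool using (Bool; true; false; _∧_; _∨_; not; if_then_else_)
open import Data.Nat as ℕ using (ℕ; zero; suc; _≡ᵇ_; _<_; _≤_)
open import Data.Nat.Properties using (m^n≢0)
open import Data.Integer as ℤ using (ℤ; +_; -[1+_]; ∣_∣)
open import Data.List using (List; []; _∷_; _++_; length; upTo; filter; foldr)
open import Data.Maybe using (Maybe; just; nothing)
open import Data.Product using (Σ; ∃; _×_; _,_)
open import Relation.Binary.PropositionalEquality using (_≡_; _≢_)
open import Relation.Nullary using (¬_)

-- A state S = (a_ℓ, …, a_1, a_0) is represented LITTLE-ENDIAN
-- as the list  a_0 ∷ a_1 ∷ … ∷ a_ℓ ∷ []  (so list position = index i).
-- The empty list is not a state; P treats it as halting.

State : Set
State = List ℤ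

isOdd : ℤ → Bool
isOdd z = ∣ z ∣ ℕ.% 2 ≡ᵇ 1

isOddℕ : ℕ → Bool
isOddℕ n = n ℕ.% 2 ≡ᵇ 1

allEven : List ℤ → Bool
allEven []       = true
allEven (x ∷ xs) = not (isOdd x) ∧ allEven xs

isZeroℤ : ℤ → Bool
isZeroℤ (+ 0) = true
isZeroℤ _     = false

isMinusOne : ℤ → Bool
isMinusOne -[1+ 0 ] = true
isMinusOne _        = false

ellOf : State → ℕ
ellOf xs = length xs ℕ.∸ 1

-- last entry a_ℓ and the preceding entry a_{ℓ-1}
-- (for ℓ = 0 the missing a_{ℓ-1} is read as 0)
lastE : State → ℤ
lastE []           = + 0
lastE (x ∷ [])     = x
lastE (x ∷ y ∷ ys) = lastE (y ∷ ys)

secondLastE : State → ℤ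
secondLastE []               = + 0
secondLastE (x ∷ [])         = + 0
secondLastE (x ∷ y ∷ [])     = x
secondLastE (x ∷ y ∷ z ∷ zs) = secondLastE (y ∷ z ∷ zs)

initE : State → List ℤ
initE []           = []
initE (x ∷ [])     = []
initE (x ∷ y ∷ ys) = x ∷ initE (y ∷ ys)

incHead : List ℤ → List ℤ
incHead []       = []
incHead (x ∷ xs) = (x ℤ.+ + 1) ∷ xs

decHead : List ℤ → List ℤ
decHead []       = []
decHead (x ∷ xs) = (x ℤ.- + 1) ∷ xs

bumpAfterFirstOdd : List ℤ → List ℤ
bumpAfterFirstOdd []       = []
bumpAfterFirstOdd (x ∷ xs) =
  if isOdd x then x ∷ incHead xs else x ∷ bumpAfterFirstOdd xs

data Rule : Set where
  Overflow Halt Zero Halve Increment : Rule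

rule : State → Rule
rule []       = Halt
rule (x ∷ xs) =
  if isOdd (lastE (x ∷ xs)) ∧ allEven (initE (x ∷ xs)) then Overflow
  else if allEven (x ∷ xs) then
         (if isZeroℤ (lastE (x ∷ xs)) ∧ isZeroℤ (secondLastE (x ∷ xs))
          then Halt else Zero)
  else if isMinusOne x then Halve
  else Increment

-- the successor P(S); nothing = the process halts
stepP : State → Maybe State
stepP []       = nothing
stepP (x ∷ xs) with rule (x ∷ xs)
... | Overflow  = just (initE (x ∷ xs) ++ ((lastE (x ∷ xs) ℤ.+ + 1) ∷ + 0 ∷ []))
... | Halt      = nothing
... | Zero      = just (decHead (initE (x ∷ xs) ++ ((lastE (x ∷ xs) ℤ.+ + 1) ∷ + 0 ∷ + 0 ∷ [])))
... | Halve     = just xs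
... | Increment = just (decHead (bumpAfterFirstOdd (x ∷ xs)))

iterP : ℕ → State → Maybe State
iterP zero    s = just s
iterP (suc j) s with iterP j s
... | nothing = nothing
... | just t  = stepP t

_↦_ : State → State → Set
S ↦ T = ∃ λ j → iterP j S ≡ just T

ruleAt : ℕ → State → Maybe Rule
ruleAt j s with iterP j s
... | nothing = nothing
... | just t  = just (rule t)

-- ⟨ n / 2^i ⟩ (nearest integer, halves rounded up) = ⌊(2n + 2^i) / 2^(i+1)⌋
roundDiv : ℕ → ℕ → ℕ
roundDiv n i = ℕ._/_ (2 ℕ.* n ℕ.+ 2 ℕ.^ i) (2 ℕ.^ suc i) {{m^n≢0 2 (suc i)}}

bitsOk : ℕ → ℕ → List ℤ → Bool
bitsOk n i []       = true
bitsOk n i (a ∷ as) =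
  (if isOddℕ (roundDiv n i) then isOdd a else not (isOdd a)) ∧ bitsOk n (suc i) as

NCond : State → ℕ → Bool
NCond []       n = true
NCond (a ∷ as) n = bitsOk n 1 as

firstMaybe : List ℕ → ℕ
firstMaybe []      = 0
firstMaybe (x ∷ _) = x

-- n(S): the (unique) 0 ≤ n < 2^ℓ with ⟨n/2^i⟩ ≡ a_i (mod 2) for 1 ≤ i ≤ ℓ,
-- computed as the least such n by search.
nOf : State → ℕ
nOf s = firstMaybe (filter (λ n → Data.Bool.T? (NCond s n)) (upTo (2 ℕ.^ ellOf s)))
  where import Data.Bool

nOfM : Maybe State → ℕ
nOfM nothing  = 0
nOfM (just s) = nOf s

-- σ(S) = -1  iff the sum of the entries is even
sumEven : State → Set
sumEven s = isOdd (foldr ℤ._+_ (+ 0) s) ≡ false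

IsEmpty : State → Set
IsEmpty s = (nOf s ≡ 0) × sumEven s × (rule s ≢ Halt)

-- P^j(E) exists and lies in the range of T_E, i.e. no P^{j'}(E) with
-- 1 ≤ j' ≤ j is empty  (so the rule applied at P^j(E) belongs to T_E)
InT : State → ℕ → Set
InT E j = (∃ λ t → iterP j E ≡ just t) ×
          (∀ j' t → 1 ≤ j' → j' ≤ j → iterP j' E ≡ just t → ¬ IsEmpty t)

WeaklyEmbankedAt : State → ℕ → ℕ → Set
WeaklyEmbankedAt E j₁ j₂ =
  IsEmpty E × ruleAt 0 E ≡ just Zero × 0 < j₁ × j₁ < j₂ × InT E j₂ ×
  ruleAt j₁ E ≡ just Halve × ruleAt j₂ E ≡ just Halve ×
  (∀ j → 0 < j → j < j₂ → j ≢ j₁ → ruleAt j E ≡ just Increment)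

Embanked : State → Set
Embanked E =
  IsEmpty E × ruleAt 0 E ≡ just Zero ×
  ∃ λ j₁ → ∃ λ j₂ → 0 < j₁ × j₁ < j₂ × InT E j₂ ×
    ruleAt j₁ E ≡ just Halve × ruleAt j₂ E ≡ just Halve ×
    (∀ j → 0 < j → InT E j → j ≢ j₁ → j ≢ j₂ → ruleAt j E ≡ just Increment)

-- h_i and s_i, given the positions of the Halve rules
hAt : State → ℕ → ℕ
hAt E j = nOfM (iterP (suc j) E)

sAt : State → ℕ → ℕ
sAt E j = nOfM (iterP j E)

-- E[i] : add 2 to the i-th entry

bumpAt : ℕ → State → State
bumpAt i       []       = []
bumpAt zero    (x ∷ xs) = (x ℤ.+ + 2) ∷ xs
bumpAt (suc i) (x ∷ xs) = x ∷ bumpAt i xs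

powsDown : ℕ → List ℤ
powsDown zero    = []
powsDown (suc m) = + (2 ℕ.^ suc m) ∷ powsDown m

Sk : ℕ → State
Sk k = + 0 ∷ (powsDown (2 ℕ.* k) ++ (+ 0 ∷ []))

-- n(S) depends only on the parities of a_1, …, a_ℓ, read as a reflected Gray
-- code.  An Increment rule performs one Gray-code step on them, so it moves n by
-- +1 or -1 according to σ, which it preserves, and it lowers a_0 by one.  Hence
-- along T_E: after the Zero rule σ = -1, so s₁ = n(P(E)) - c₁, where the number
-- c₁ of Increments before the first Halve is a_0(P(E)) + 1; then h₁ = ⌊s₁/2⌋;
-- after the Halve σ = +1, so s₂ = h₁ + c₂ with c₂ = a_1 + 1 read at the first
-- Halve, and h₂ = ⌊s₂/2⌋.  Adding 2 to a_i commutes with every rule involved and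
-- changes neither n nor σ.  It only delays the first Halve by two Increments when
-- i = 0 (which also carry once more into a_1, so c₂ grows by one), and it raises
-- c₂ by two when i = 1.

module Submission where

open import Defs
open import Data.Nat using (ℕ; suc; _≤_; _+_)
open import Data.Integer using (+_; _-_)
open import Data.Product using (_×_)
open import Relation.Binary.PropositionalEquality using (_≡_)
open import Relation.Nullary using (¬_)

open import Data.Bool using (Bool; true; false; not; _∧_; _xor_; if_then_else_)
open import Data.Bool.Properties using (not-involutive; not-distribˡ-xor; not-distribʳ-xor)
open import Data.Integer as ℤ using (ℤ; -[1+_])
import Data.Integer.Properties as ℤₚ
open import Data.List using (List; []; _∷_; _++_; length; filter; applyUpTo)
open import Data.List.Properties using (∷-injectiveˡ; ∷-injectiveʳ)
open import Data.Maybe using (just)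
open import Data.Maybe.Properties using (just-injective)
open import Data.Nat using (zero; _<_; _*_; _^_; _/_; _∸_; z≤n; s≤s)
import Data.Nat.Properties as ℕₚ
open import Data.Nat.DivMod using (+-distrib-/-∣ʳ; m*n/n≡m; m*n/m*o≡n/o; m/n/o≡m/[n*o]; m<n*o⇒m/o<n; m/n≡1+[m∸n]/n)
open import Data.Nat.Divisibility using (divides)
open import Data.Product using (∃₂; _,_; proj₁; proj₂)
open import Data.Sum using (_⊎_; inj₁; inj₂)
open import Data.Unit using (⊤; tt)
open import Function using (_∘_)
open import Relation.Binary.PropositionalEquality using (refl; sym; trans; cong; cong₂; subst; module ≡-Reasoning)
import Algebra.Properties.CommutativeSemigroup as CommutativeSemigroupProperties
open import Relation.Nullary.Decidable.Core using (T?)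
open import Relation.Nullary.Negation using (contradiction)

module ℕ+ = CommutativeSemigroupProperties ℕₚ.+-commutativeSemigroup
module ℤ+ = CommutativeSemigroupProperties ℤₚ.+-commutativeSemigroup

isOddℕ-suc : ∀ n → isOddℕ (suc n) ≡ not (isOddℕ n)
isOddℕ-suc zero          = refl
isOddℕ-suc (suc zero)    = refl
isOddℕ-suc (suc (suc n)) = isOddℕ-suc n

isOdd-+1 : ∀ x → isOdd (x ℤ.+ + 1) ≡ not (isOdd x)
isOdd-+1 (+ n)            = subst (λ m → isOddℕ m ≡ not (isOddℕ n)) (ℕₚ.+-comm 1 n) (isOddℕ-suc n)
isOdd-+1 -[1+ zero ]      = refl
isOdd-+1 -[1+ suc n ]     = isOddℕ-suc n

isOdd--1 : ∀ x → isOdd (x ℤ.- + 1) ≡ not (isOdd x)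
isOdd--1 x = begin
  isOdd (x ℤ.- + 1)                    ≡⟨ not-involutive _ ⟨
  not (not (isOdd (x ℤ.- + 1)))        ≡⟨ cong not (isOdd-+1 (x ℤ.- + 1)) ⟨
  not (isOdd (x ℤ.- + 1 ℤ.+ + 1))      ≡⟨ cong (not ∘ isOdd) (trans (ℤₚ.+-assoc x -[1+ 0 ] (+ 1)) (ℤₚ.+-identityʳ x)) ⟩
  not (isOdd x)                        ∎
  where open ≡-Reasoning

isOdd-+2 : ∀ x → isOdd (x ℤ.+ + 2) ≡ isOdd x
isOdd-+2 x = begin
  isOdd (x ℤ.+ + 2)              ≡⟨ cong isOdd (ℤₚ.+-assoc x (+ 1) (+ 1)) ⟨
  isOdd (x ℤ.+ + 1 ℤ.+ + 1)      ≡⟨ isOdd-+1 (x ℤ.+ + 1) ⟩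
  not (isOdd (x ℤ.+ + 1))        ≡⟨ cong not (isOdd-+1 x) ⟩
  not (not (isOdd x))            ≡⟨ not-involutive _ ⟩
  isOdd x                        ∎
  where open ≡-Reasoning

-- n(S) as a Gray-code value

parity : List ℤ → Bool
parity []       = false
parity (a ∷ as) = isOdd a xor parity as

bit : Bool → ℕ
bit false = 0
bit true  = 1

-- n(a_0 ∷ as) = grayValue as (nOf-∷): the number whose reflected Gray code,
-- least significant digit first, is the list of parities of as.  Its binary
-- digit at position i is the xor of the Gray digits at positions ≥ i.
grayValue : List ℤ → ℕ
grayValue []       = 0
grayValue (a ∷ as) = bit (isOdd a xor parity as) + grayValue as * 2

xor-cancelʳ : ∀ x y → (x xor y) xor y ≡ x
xor-cancelʳ true  true  = refl
xor-cancelʳ true  false = refl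
xor-cancelʳ false true  = refl
xor-cancelʳ false false = refl

∧-true : ∀ {x y} → x ∧ y ≡ true → x ≡ true × y ≡ true
∧-true {true} {true} refl = refl , refl

bit-view : ∀ n → ∃₂ λ b q → n ≡ bit b + q * 2
bit-view zero = false , 0 , refl
bit-view (suc n) with bit-view n
... | false , q , refl = true  , q     , refl
... | true  , q , refl = false , suc q , refl

isOddℕ-bit+q*2 : ∀ b q → isOddℕ (bit b + q * 2) ≡ b
isOddℕ-bit+q*2 false zero    = refl
isOddℕ-bit+q*2 true  zero    = refl
isOddℕ-bit+q*2 b     (suc q) = begin
  isOddℕ (bit b + suc q * 2)      ≡⟨ cong isOddℕ (trans (ℕₚ.+-suc (bit b) _) (cong suc (ℕₚ.+-suc (bit b) _))) ⟩
  isOddℕ (suc (suc (bit b + q * 2))) ≡⟨ isOddℕ-bit+q*2 b q ⟩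
  b                                ∎
  where open ≡-Reasoning

[r+q*2]/2≡r/2+q : ∀ r q → (r + q * 2) / 2 ≡ r / 2 + q
[r+q*2]/2≡r/2+q r q = trans (+-distrib-/-∣ʳ r (divides q refl)) (cong (λ m → r / 2 + m) (m*n/n≡m q 2))

bit+q*2/2≡q : ∀ b q → (bit b + q * 2) / 2 ≡ q
bit+q*2/2≡q false q = [r+q*2]/2≡r/2+q 0 q
bit+q*2/2≡q true  q = [r+q*2]/2≡r/2+q 1 q

isOddℕ-[bit+q*2+1]/2 : ∀ b q → isOddℕ ((bit b + q * 2 + 1) / 2) ≡ b xor isOddℕ q
isOddℕ-[bit+q*2+1]/2 false q = cong isOddℕ (trans (cong (_/ 2) (ℕₚ.+-comm (q * 2) 1)) (bit+q*2/2≡q true q))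
isOddℕ-[bit+q*2+1]/2 true  q =
  trans (cong isOddℕ (trans (cong (λ m → suc m / 2) (ℕₚ.+-comm (q * 2) 1)) ([r+q*2]/2≡r/2+q 2 q))) (isOddℕ-suc q)

isOddℕ-grayValue : ∀ as → isOddℕ (grayValue as) ≡ parity as
isOddℕ-grayValue []       = refl
isOddℕ-grayValue (a ∷ as) = isOddℕ-bit+q*2 (isOdd a xor parity as) (grayValue as)

grayValue-< : ∀ as → grayValue as < 2 ^ length as
grayValue-< []       = s≤s z≤n
grayValue-< (a ∷ as) = begin-strict
  bit b + m * 2          ≤⟨ ℕₚ.+-monoˡ-≤ (m * 2) (bit≤1 b) ⟩
  1 + m * 2              <⟨ ℕₚ.n<1+n _ ⟩
  suc m * 2              ≤⟨ ℕₚ.*-monoˡ-≤ 2 (grayValue-< as) ⟩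
  2 ^ length as * 2      ≡⟨ ℕₚ.*-comm (2 ^ length as) 2 ⟩
  2 ^ length (a ∷ as)    ∎
  where
  open ℕₚ.≤-Reasoning
  m = grayValue as
  b = isOdd a xor parity as
  bit≤1 : ∀ b → bit b ≤ 1
  bit≤1 false = z≤n
  bit≤1 true  = s≤s z≤n

_/2^_ : ℕ → ℕ → ℕ
m /2^ k = (m / 2 ^ k) {{ℕₚ.m^n≢0 2 k}}

sameParity : ℕ → ℤ → Bool
sameParity m a = if isOddℕ m then isOdd a else not (isOdd a)

sameParity⇒≡ : ∀ m a → sameParity m a ≡ true → isOddℕ m ≡ isOdd a
sameParity⇒≡ m a eq with isOddℕ m | isOdd a
... | true  | true  = refl
... | false | false = refl
sameParity⇒≡ m a () | true  | false
sameParity⇒≡ m a () | false | true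

≡⇒sameParity : ∀ m a → isOddℕ m ≡ isOdd a → sameParity m a ≡ true
≡⇒sameParity m a eq with isOddℕ m | isOdd a
≡⇒sameParity m a refl | true  | true  = refl
≡⇒sameParity m a refl | false | false = refl

roundDiv-suc : ∀ n j → roundDiv n (suc j) ≡ (n + 2 ^ j) /2^ suc j
roundDiv-suc n j =
  trans (cong (_/2^ suc (suc j)) (sym (ℕₚ.*-distribˡ-+ 2 n (2 ^ j))))
        (m*n/m*o≡n/o 2 (n + 2 ^ j) (2 ^ suc j) {{ℕₚ.m^n≢0 2 (suc j)}} {{ℕₚ.m^n≢0 2 (suc (suc j))}})

roundDiv-half : ∀ n j → (n + 2 ^ suc j) /2^ suc (suc j) ≡ (n / 2 + 2 ^ j) /2^ suc j
roundDiv-half n j = begin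
  (n + 2 ^ suc j) /2^ suc (suc j)   ≡⟨ m/n/o≡m/[n*o] (n + 2 ^ suc j) 2 (2 ^ suc j)
                                         {{_}} {{ℕₚ.m^n≢0 2 (suc j)}} {{ℕₚ.m^n≢0 2 (suc (suc j))}} ⟨
  ((n + 2 ^ suc j) / 2) /2^ suc j   ≡⟨ cong (_/2^ suc j) half ⟩
  (n / 2 + 2 ^ j) /2^ suc j         ∎
  where
  open ≡-Reasoning
  half : (n + 2 * 2 ^ j) / 2 ≡ n / 2 + 2 ^ j
  half = trans (cong (λ m → (n + m) / 2) (ℕₚ.*-comm 2 (2 ^ j))) ([r+q*2]/2≡r/2+q n (2 ^ j))

bitsOk-shift : ∀ n i as → bitsOk n (suc (suc i)) as ≡ bitsOk (n / 2) (suc i) as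
bitsOk-shift n i []       = refl
bitsOk-shift n i (a ∷ as) = cong₂ _∧_ (cong (λ m → sameParity m a) digit) (bitsOk-shift n (suc i) as)
  where
  digit : roundDiv n (suc (suc i)) ≡ roundDiv (n / 2) (suc i)
  digit = trans (roundDiv-suc n (suc i)) (trans (roundDiv-half n i) (sym (roundDiv-suc (n / 2) i)))

bitsOk-∷ : ∀ n a as → bitsOk n 1 (a ∷ as) ≡ sameParity ((n + 1) / 2) a ∧ bitsOk (n / 2) 1 as
bitsOk-∷ n a as = cong₂ _∧_ (cong (λ m → sameParity m a) (roundDiv-suc n 0)) (bitsOk-shift n 0 as)

bitsOk-grayValue : ∀ as → bitsOk (grayValue as) 1 as ≡ true
bitsOk-grayValue []       = refl
bitsOk-grayValue (a ∷ as) = begin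
  bitsOk (bit b + m * 2) 1 (a ∷ as)                                    ≡⟨ bitsOk-∷ (bit b + m * 2) a as ⟩
  sameParity ((bit b + m * 2 + 1) / 2) a ∧ bitsOk ((bit b + m * 2) / 2) 1 as ≡⟨ cong₂ _∧_ digit rest ⟩
  true                                                                 ∎
  where
  open ≡-Reasoning
  m = grayValue as
  b = isOdd a xor parity as
  digit : sameParity ((bit b + m * 2 + 1) / 2) a ≡ true
  digit = ≡⇒sameParity ((bit b + m * 2 + 1) / 2) a (begin
    isOddℕ ((bit b + m * 2 + 1) / 2)  ≡⟨ isOddℕ-[bit+q*2+1]/2 b m ⟩
    b xor isOddℕ m                     ≡⟨ cong (b xor_) (isOddℕ-grayValue as) ⟩
    (isOdd a xor parity as) xor parity as ≡⟨ xor-cancelʳ (isOdd a) (parity as) ⟩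
    isOdd a                            ∎)
  rest : bitsOk ((bit b + m * 2) / 2) 1 as ≡ true
  rest = trans (cong (λ n → bitsOk n 1 as) (bit+q*2/2≡q b m)) (bitsOk-grayValue as)

bitsOk⇒grayValue : ∀ as n → n < 2 ^ length as → bitsOk n 1 as ≡ true → n ≡ grayValue as
bitsOk⇒grayValue []       zero    _        _  = refl
bitsOk⇒grayValue []       (suc n) (s≤s ()) _
bitsOk⇒grayValue (a ∷ as) n       n<       ok with bit-view n
... | b , q , refl = cong₂ (λ b q → bit b + q * 2) b≡ q≡
  where
  tests = ∧-true (trans (sym (bitsOk-∷ (bit b + q * 2) a as)) ok)
  q< : q < 2 ^ length as
  q< = subst (_< 2 ^ length as) (bit+q*2/2≡q b q)
         (m<n*o⇒m/o<n (subst (bit b + q * 2 <_) (ℕₚ.*-comm 2 (2 ^ length as)) n<))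
  q≡ : q ≡ grayValue as
  q≡ = bitsOk⇒grayValue as q q< (subst (λ m → bitsOk m 1 as ≡ true) (bit+q*2/2≡q b q) (proj₂ tests))
  b≡ : b ≡ isOdd a xor parity as
  b≡ = begin
    b                               ≡⟨ xor-cancelʳ b (isOddℕ q) ⟨
    (b xor isOddℕ q) xor isOddℕ q   ≡⟨ cong₂ _xor_ b-digit (trans (cong isOddℕ q≡) (isOddℕ-grayValue as)) ⟩
    isOdd a xor parity as           ∎
    where
    open ≡-Reasoning
    b-digit : b xor isOddℕ q ≡ isOdd a
    b-digit = trans (sym (isOddℕ-[bit+q*2+1]/2 b q)) (sameParity⇒≡ ((bit b + q * 2 + 1) / 2) a (proj₁ tests))

head-filter-applyUpTo : ∀ (p : ℕ → Bool) f N t → t < N →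
  (∀ m → m < t → p (f m) ≡ false) → p (f t) ≡ true →
  firstMaybe (filter (λ x → T? (p x)) (applyUpTo f N)) ≡ f t
head-filter-applyUpTo p f (suc N) zero    _         _      pt rewrite pt = refl
head-filter-applyUpTo p f (suc N) (suc t) (s≤s t<N) before pt rewrite before 0 (s≤s z≤n) =
  head-filter-applyUpTo p (f ∘ suc) N t t<N (λ m m<t → before (suc m) (s≤s m<t)) pt

nOf-∷ : ∀ x xs → nOf (x ∷ xs) ≡ grayValue xs
nOf-∷ x xs = head-filter-applyUpTo (λ n → bitsOk n 1 xs) (λ n → n) (2 ^ length xs) (grayValue xs)
               (grayValue-< xs) below (bitsOk-grayValue xs)
  where
  below : ∀ m → m < grayValue xs → bitsOk m 1 xs ≡ false
  below m m< with bitsOk m 1 xs in ok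
  ... | false = refl
  ... | true  = contradiction (bitsOk⇒grayValue xs m (ℕₚ.<-trans m< (grayValue-< xs)) ok) (ℕₚ.<⇒≢ m<)

nOf-halve : ∀ w y ys → nOf (y ∷ ys) ≡ nOf (w ∷ y ∷ ys) / 2
nOf-halve w y ys = begin
  nOf (y ∷ ys)           ≡⟨ nOf-∷ y ys ⟩
  grayValue ys           ≡⟨ bit+q*2/2≡q (isOdd y xor parity ys) (grayValue ys) ⟨
  grayValue (y ∷ ys) / 2 ≡⟨ cong (_/ 2) (nOf-∷ w (y ∷ ys)) ⟨
  nOf (w ∷ y ∷ ys) / 2   ∎
  where open ≡-Reasoning

-- Increment rules as Gray-code steps

Shift : Bool → ℕ → ℕ → ℕ → Set
Shift true  c m n = n ≡ c + m
Shift false c m n = c + n ≡ m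

Shift-suc : ∀ b {c m n n′} → Shift b c m n → Shift b 1 n n′ → Shift b (suc c) m n′
Shift-suc true  refl refl = refl
Shift-suc false {c} {n′ = n′} refl refl = sym (ℕₚ.+-suc c n′)

Shift-flip : ∀ b m → Shift (not b) 1 (bit b + m * 2) (bit (not b) + m * 2)
Shift-flip false m = refl
Shift-flip true  m = refl

Shift-double : ∀ b {m m′} → Shift b 1 m m′ → Shift b 1 (bit b + m * 2) (bit (not b) + m′ * 2)
Shift-double false refl = refl
Shift-double true  refl = refl

-- An Increment rule acts on (a_ℓ, …, a_1) by one Gray-code step: if a_0 is odd
-- it changes a_1, otherwise the entry after the first odd one; canStep says
-- that this entry exists.
grayStep : Bool → List ℤ → List ℤ
grayStep true  = incHead
grayStep false = bumpAfterFirstOdd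

canStep : Bool → List ℤ → Bool
canStep _     []       = false
canStep true  (_ ∷ _)  = true
canStep false (y ∷ ys) = canStep (isOdd y) ys

bumpAfterFirstOdd-∷ : ∀ y ys → bumpAfterFirstOdd (y ∷ ys) ≡ y ∷ grayStep (isOdd y) ys
bumpAfterFirstOdd-∷ y ys with isOdd y
... | true  = refl
... | false = refl

parity-grayStep : ∀ b xs → canStep b xs ≡ true → parity (grayStep b xs) ≡ not (parity xs)
parity-grayStep true  (y ∷ ys) _ = trans (cong (_xor parity ys) (isOdd-+1 y)) (sym (not-distribˡ-xor (isOdd y) (parity ys)))
parity-grayStep false (y ∷ ys) ok = begin
  parity (bumpAfterFirstOdd (y ∷ ys))       ≡⟨ cong parity (bumpAfterFirstOdd-∷ y ys) ⟩
  isOdd y xor parity (grayStep (isOdd y) ys) ≡⟨ cong (isOdd y xor_) (parity-grayStep (isOdd y) ys ok) ⟩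
  isOdd y xor not (parity ys)                ≡⟨ not-distribʳ-xor (isOdd y) (parity ys) ⟨
  not (parity (y ∷ ys))                      ∎
  where open ≡-Reasoning

grayValue-grayStep : ∀ b xs → canStep b xs ≡ true →
  Shift (b xor parity xs) 1 (grayValue xs) (grayValue (grayStep b xs))
grayValue-grayStep true (y ∷ ys) _ =
  subst (λ d → Shift (not (isOdd y xor parity ys)) 1 (grayValue (y ∷ ys)) (bit d + grayValue ys * 2)) flipped
        (Shift-flip (isOdd y xor parity ys) (grayValue ys))
  where
  flipped : not (isOdd y xor parity ys) ≡ isOdd (y ℤ.+ + 1) xor parity ys
  flipped = trans (not-distribˡ-xor (isOdd y) (parity ys)) (cong (_xor parity ys) (sym (isOdd-+1 y)))
grayValue-grayStep false (y ∷ ys) ok =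
  subst (λ zs → Shift (isOdd y xor parity ys) 1 (grayValue (y ∷ ys)) (grayValue zs)) (sym (bumpAfterFirstOdd-∷ y ys))
    (subst (λ d → Shift (isOdd y xor parity ys) 1 (grayValue (y ∷ ys)) (bit d + grayValue (grayStep (isOdd y) ys) * 2))
           flipped
      (Shift-double (isOdd y xor parity ys) (grayValue-grayStep (isOdd y) ys ok)))
  where
  flipped : not (isOdd y xor parity ys) ≡ isOdd y xor parity (grayStep (isOdd y) ys)
  flipped = trans (not-distribʳ-xor (isOdd y) (parity ys)) (cong (isOdd y xor_) (sym (parity-grayStep (isOdd y) ys ok)))

incStep : State → State
incStep s = decHead (bumpAfterFirstOdd s)

raiseLast : State → List ℤ
raiseLast s = initE s ++ ((lastE s ℤ.+ + 1) ∷ + 0 ∷ + 0 ∷ [])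

zeroStep : State → State
zeroStep s = decHead (raiseLast s)

incStep-∷ : ∀ x xs → incStep (x ∷ xs) ≡ (x ℤ.- + 1) ∷ grayStep (isOdd x) xs
incStep-∷ x xs = cong decHead (bumpAfterFirstOdd-∷ x xs)

overflows : State → Bool
overflows s = isOdd (lastE s) ∧ allEven (initE s)

-- rule (x ∷ xs) unfolds to ruleOf (overflows (x ∷ xs)) (allEven (x ∷ xs)) (isMinusOne x) _,
-- so the inversion lemmas below apply to rule directly.
ruleOf : (overflow even minusOne halts : Bool) → Rule
ruleOf o e m h = if o then Overflow else if e then (if h then Halt else Zero) else if m then Halve else Increment

ruleOf-Increment : ∀ o e m h → ruleOf o e m h ≡ Increment → o ≡ false × e ≡ false
ruleOf-Increment false false false _     refl = refl , refl
ruleOf-Increment true  _     _     _     ()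
ruleOf-Increment false true  _     true  ()
ruleOf-Increment false true  _     false ()
ruleOf-Increment false false true  _     ()

ruleOf-Halve : ∀ o e m h → ruleOf o e m h ≡ Halve → o ≡ false × m ≡ true
ruleOf-Halve false false true  _     refl = refl , refl
ruleOf-Halve true  _     _     _     ()
ruleOf-Halve false true  _     true  ()
ruleOf-Halve false true  _     false ()
ruleOf-Halve false false false _     ()

ruleOf-Zero : ∀ o e m h → ruleOf o e m h ≡ Zero → e ≡ true
ruleOf-Zero false true  _     false refl = refl
ruleOf-Zero true  _     _     _     ()
ruleOf-Zero false true  _     true  ()
ruleOf-Zero false false true  _     ()
ruleOf-Zero false false false _     ()

canStep-or-stuck : ∀ x xs → canStep (isOdd x) xs ≡ false → overflows (x ∷ xs) ≡ true ⊎ allEven (x ∷ xs) ≡ true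
canStep-or-stuck x [] _ with isOdd x
... | true  = inj₁ refl
... | false = inj₂ refl
canStep-or-stuck x (y ∷ ys) stuck with isOdd x
... | false = canStep-or-stuck y ys stuck
canStep-or-stuck x (y ∷ ys) () | true

Increment⇒canStep : ∀ x xs → rule (x ∷ xs) ≡ Increment → canStep (isOdd x) xs ≡ true
Increment⇒canStep x xs r with canStep (isOdd x) xs in stuck
... | true  = refl
... | false with ruleOf-Increment (overflows (x ∷ xs)) (allEven (x ∷ xs)) (isMinusOne x) _ r | canStep-or-stuck x xs stuck
...   | no-overflow , _      | inj₁ overflow = contradiction (trans (sym overflow) no-overflow) λ ()
...   | _ , not-all-even     | inj₂ all-even = contradiction (trans (sym all-even) not-all-even) λ ()

nOf-incStep : ∀ s → rule s ≡ Increment → Shift (parity s) 1 (nOf s) (nOf (incStep s))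
nOf-incStep (x ∷ xs) r
  rewrite nOf-∷ x xs | incStep-∷ x xs | nOf-∷ (x ℤ.- + 1) (grayStep (isOdd x) xs)
  = grayValue-grayStep (isOdd x) xs (Increment⇒canStep x xs r)

parity-incStep : ∀ s → rule s ≡ Increment → parity (incStep s) ≡ parity s
parity-incStep (x ∷ xs) r = begin
  parity (incStep (x ∷ xs))                              ≡⟨ cong parity (incStep-∷ x xs) ⟩
  isOdd (x ℤ.- + 1) xor parity (grayStep (isOdd x) xs)   ≡⟨ cong₂ _xor_ (isOdd--1 x) (parity-grayStep (isOdd x) xs (Increment⇒canStep x xs r)) ⟩
  not (isOdd x) xor not (parity xs)                      ≡⟨ not-distribˡ-xor (isOdd x) (not (parity xs)) ⟨
  not (isOdd x xor not (parity xs))                      ≡⟨ cong not (not-distribʳ-xor (isOdd x) (parity xs)) ⟨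
  not (not (isOdd x xor parity xs))                      ≡⟨ not-involutive _ ⟩
  parity (x ∷ xs)                                        ∎
  where open ≡-Reasoning

Zero⇒allEven : ∀ s → rule s ≡ Zero → allEven s ≡ true
Zero⇒allEven (x ∷ xs) = ruleOf-Zero (overflows (x ∷ xs)) (allEven (x ∷ xs)) (isMinusOne x) _

Halve⇒shape : ∀ s → rule s ≡ Halve → ∃₂ λ y ys → s ≡ -[1+ 0 ] ∷ y ∷ ys
Halve⇒shape (x ∷ xs) r with ruleOf-Halve (overflows (x ∷ xs)) (allEven (x ∷ xs)) (isMinusOne x) _ r
Halve⇒shape (-[1+ 0 ] ∷ y ∷ ys) r | _ = y , ys , refl
Halve⇒shape (-[1+ 0 ] ∷ [])     r | () , _
Halve⇒shape (+ _ ∷ _)           r | _ , ()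
Halve⇒shape (-[1+ suc _ ] ∷ _)  r | _ , ()

step-Increment : ∀ s → rule s ≡ Increment → stepP s ≡ just (incStep s)
step-Increment (x ∷ xs) r with rule (x ∷ xs)
step-Increment (x ∷ xs) refl | Increment = refl

step-Zero : ∀ s → rule s ≡ Zero → stepP s ≡ just (zeroStep s)
step-Zero (x ∷ xs) r with rule (x ∷ xs)
step-Zero (x ∷ xs) refl | Zero = refl

step-Halve : ∀ x xs → rule (x ∷ xs) ≡ Halve → stepP (x ∷ xs) ≡ just xs
step-Halve x xs r with rule (x ∷ xs)
step-Halve x xs refl | Halve = refl

allEven-∷ : ∀ x xs → allEven (x ∷ xs) ≡ true → isOdd x ≡ false × allEven xs ≡ true
allEven-∷ x xs even with isOdd x
... | false = refl , even
allEven-∷ x xs () | true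

parity-raiseLast : ∀ s → allEven s ≡ true → parity (raiseLast s) ≡ true
parity-raiseLast []           _    = refl
parity-raiseLast (x ∷ [])     even =
  trans (cong (_xor false) (isOdd-+1 x)) (cong (λ b → not b xor false) (proj₁ (allEven-∷ x [] even)))
parity-raiseLast (x ∷ y ∷ ys) even =
  cong₂ _xor_ (proj₁ (allEven-∷ x (y ∷ ys) even)) (parity-raiseLast (y ∷ ys) (proj₂ (allEven-∷ x (y ∷ ys) even)))

parity-zeroStep : ∀ s → allEven s ≡ true → parity (zeroStep s) ≡ false
parity-zeroStep s even with raiseLast s | parity-raiseLast s even
... | x ∷ xs | odd =
  trans (cong (_xor parity xs) (isOdd--1 x)) (trans (sym (not-distribˡ-xor (isOdd x) (parity xs))) (cong not odd))

-- Adding 2 to an entry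

incHead-bumpAt : ∀ i l → incHead (bumpAt i l) ≡ bumpAt i (incHead l)
incHead-bumpAt i       []       = refl
incHead-bumpAt zero    (x ∷ xs) = cong (_∷ xs) (ℤ+.xy∙z≈xz∙y x (+ 2) (+ 1))
incHead-bumpAt (suc i) (x ∷ xs) = refl

decHead-bumpAt : ∀ i l → decHead (bumpAt i l) ≡ bumpAt i (decHead l)
decHead-bumpAt i       []       = refl
decHead-bumpAt zero    (x ∷ xs) = cong (_∷ xs) (ℤ+.xy∙z≈xz∙y x (+ 2) -[1+ 0 ])
decHead-bumpAt (suc i) (x ∷ xs) = refl

grayStep-bumpAt : ∀ b i l → grayStep b (bumpAt i l) ≡ bumpAt i (grayStep b l)
grayStep-bumpAt true  i       l        = incHead-bumpAt i l
grayStep-bumpAt false i       []       = refl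
grayStep-bumpAt false zero    (x ∷ xs) = begin
  bumpAfterFirstOdd ((x ℤ.+ + 2) ∷ xs)     ≡⟨ bumpAfterFirstOdd-∷ (x ℤ.+ + 2) xs ⟩
  (x ℤ.+ + 2) ∷ grayStep (isOdd (x ℤ.+ + 2)) xs ≡⟨ cong (λ b → (x ℤ.+ + 2) ∷ grayStep b xs) (isOdd-+2 x) ⟩
  bumpAt zero (x ∷ grayStep (isOdd x) xs)  ≡⟨ cong (bumpAt zero) (bumpAfterFirstOdd-∷ x xs) ⟨
  bumpAt zero (bumpAfterFirstOdd (x ∷ xs)) ∎
  where open ≡-Reasoning
grayStep-bumpAt false (suc i) (x ∷ xs) = begin
  bumpAfterFirstOdd (x ∷ bumpAt i xs)         ≡⟨ bumpAfterFirstOdd-∷ x (bumpAt i xs) ⟩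
  x ∷ grayStep (isOdd x) (bumpAt i xs)        ≡⟨ cong (x ∷_) (grayStep-bumpAt (isOdd x) i xs) ⟩
  bumpAt (suc i) (x ∷ grayStep (isOdd x) xs)  ≡⟨ cong (bumpAt (suc i)) (bumpAfterFirstOdd-∷ x xs) ⟨
  bumpAt (suc i) (bumpAfterFirstOdd (x ∷ xs)) ∎
  where open ≡-Reasoning

incStep-bumpAt : ∀ i l → incStep (bumpAt i l) ≡ bumpAt i (incStep l)
incStep-bumpAt i l = trans (cong decHead (grayStep-bumpAt false i l)) (decHead-bumpAt i (bumpAfterFirstOdd l))

raiseLast-bumpAt : ∀ i x xs → i ≤ length xs → raiseLast (bumpAt i (x ∷ xs)) ≡ bumpAt i (raiseLast (x ∷ xs))
raiseLast-bumpAt zero          x []       _         = cong (_∷ _) (ℤ+.xy∙z≈xz∙y x (+ 2) (+ 1))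
raiseLast-bumpAt zero          x (y ∷ ys) _         = refl
raiseLast-bumpAt (suc zero)    x (y ∷ ys) _         = cong (x ∷_) (raiseLast-bumpAt zero y ys z≤n)
raiseLast-bumpAt (suc (suc i)) x (y ∷ ys) (s≤s i≤) = cong (x ∷_) (raiseLast-bumpAt (suc i) y ys i≤)

zeroStep-bumpAt : ∀ i x xs → i ≤ length xs → zeroStep (bumpAt i (x ∷ xs)) ≡ bumpAt i (zeroStep (x ∷ xs))
zeroStep-bumpAt i x xs i≤ = trans (cong decHead (raiseLast-bumpAt i x xs i≤)) (decHead-bumpAt i (raiseLast (x ∷ xs)))

parity-bumpAt : ∀ i l → parity (bumpAt i l) ≡ parity l
parity-bumpAt i       []       = refl
parity-bumpAt zero    (x ∷ xs) = cong (_xor parity xs) (isOdd-+2 x)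
parity-bumpAt (suc i) (x ∷ xs) = cong (isOdd x xor_) (parity-bumpAt i xs)

grayValue-bumpAt : ∀ i l → grayValue (bumpAt i l) ≡ grayValue l
grayValue-bumpAt i       []       = refl
grayValue-bumpAt zero    (x ∷ xs) = cong (λ b → bit (b xor parity xs) + grayValue xs * 2) (isOdd-+2 x)
grayValue-bumpAt (suc i) (x ∷ xs) =
  cong₂ (λ p m → bit (isOdd x xor p) + m * 2) (parity-bumpAt i xs) (grayValue-bumpAt i xs)

nOf-bumpAt : ∀ i l → nOf (bumpAt i l) ≡ nOf l
nOf-bumpAt i       []       = refl
nOf-bumpAt zero    (x ∷ xs) = trans (nOf-∷ (x ℤ.+ + 2) xs) (sym (nOf-∷ x xs))
nOf-bumpAt (suc i) (x ∷ xs) = trans (nOf-∷ x (bumpAt i xs)) (trans (grayValue-bumpAt i xs) (sym (nOf-∷ x xs)))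

-- Runs of Increment rules

incSteps : ℕ → State → State
incSteps zero    s = s
incSteps (suc c) s = incStep (incSteps c s)

IncrementsFrom : State → ℕ → Set
IncrementsFrom s zero    = ⊤
IncrementsFrom s (suc c) = IncrementsFrom s c × rule (incSteps c s) ≡ Increment

incSteps-bumpAt : ∀ i c l → incSteps c (bumpAt i l) ≡ bumpAt i (incSteps c l)
incSteps-bumpAt i zero    l = refl
incSteps-bumpAt i (suc c) l = trans (cong incStep (incSteps-bumpAt i c l)) (incStep-bumpAt i (incSteps c l))

incSteps-[] : ∀ c → incSteps c [] ≡ []
incSteps-[] zero    = refl
incSteps-[] (suc c) = cong incStep (incSteps-[] c)

parity-incSteps : ∀ s c → IncrementsFrom s c → parity (incSteps c s) ≡ parity s
parity-incSteps s zero    _         = refl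
parity-incSteps s (suc c) (run , r) = trans (parity-incStep (incSteps c s) r) (parity-incSteps s c run)

nOf-incSteps : ∀ s c → IncrementsFrom s c → Shift (parity s) c (nOf s) (nOf (incSteps c s))
nOf-incSteps s zero    _         = Shift-zero (parity s)
  where
  Shift-zero : ∀ b → Shift b 0 (nOf s) (nOf s)
  Shift-zero true  = refl
  Shift-zero false = refl
nOf-incSteps s (suc c) (run , r) =
  Shift-suc (parity s) (nOf-incSteps s c run)
    (subst (λ b → Shift b 1 (nOf (incSteps c s)) (nOf (incSteps (suc c) s))) (parity-incSteps s c run)
      (nOf-incStep (incSteps c s) r))

-- No rule hypothesis is needed: incStep lowers a_0 by one on every nonempty list.
incSteps-head : ∀ c x xs {w ws} → incSteps c (x ∷ xs) ≡ w ∷ ws → x ≡ w ℤ.+ + c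
incSteps-head zero    x xs {w} eq = trans (∷-injectiveˡ eq) (sym (ℤₚ.+-identityʳ w))
incSteps-head (suc c) x xs {w} eq with incSteps c (x ∷ xs) in eq′
... | v ∷ vs = begin
  x                              ≡⟨ incSteps-head c x xs eq′ ⟩
  v ℤ.+ + c                      ≡⟨ ℤₚ.+-assoc v -[1+ 0 ] (+ suc c) ⟨
  (v ℤ.- + 1) ℤ.+ + suc c        ≡⟨ cong (ℤ._+ + suc c) (∷-injectiveˡ (trans (sym (incStep-∷ v vs)) eq)) ⟩
  w ℤ.+ + suc c                  ∎
  where open ≡-Reasoning
incSteps-head (suc c) x xs () | []

-1+-injective : ∀ m n → -[1+ 0 ] ℤ.+ + m ≡ -[1+ 0 ] ℤ.+ + n → m ≡ n
-1+-injective zero    zero    _  = refl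
-1+-injective (suc m) (suc n) eq = cong suc (ℤₚ.+-injective eq)
-1+-injective zero    (suc n) ()
-1+-injective (suc m) zero    ()

countdown-shift : ∀ {c c′ d x x′ xs xs′ ws ws′} → x′ ≡ x ℤ.+ + d →
  incSteps c (x ∷ xs) ≡ -[1+ 0 ] ∷ ws → incSteps c′ (x′ ∷ xs′) ≡ -[1+ 0 ] ∷ ws′ → c′ ≡ c + d
countdown-shift {c} {c′} {d} {x} {x′} x′≡ run run′ = -1+-injective c′ (c + d) (begin
  -[1+ 0 ] ℤ.+ + c′              ≡⟨ incSteps-head c′ x′ _ run′ ⟨
  x′                             ≡⟨ x′≡ ⟩
  x ℤ.+ + d                      ≡⟨ cong (ℤ._+ + d) (incSteps-head c x _ run) ⟩
  -[1+ 0 ] ℤ.+ + c ℤ.+ + d       ≡⟨ ℤₚ.+-assoc -[1+ 0 ] (+ c) (+ d) ⟩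
  -[1+ 0 ] ℤ.+ + (c + d)         ∎)
  where open ≡-Reasoning

countdown-bumpAt-zero : ∀ A {c c′ y y′ ys ys′} →
  incSteps c A ≡ -[1+ 0 ] ∷ y ∷ ys → incSteps c′ (bumpAt 0 A) ≡ -[1+ 0 ] ∷ y′ ∷ ys′ →
  c′ ≡ c + 2 × y′ ≡ y ℤ.+ + 1
countdown-bumpAt-zero []       {c} run _ = contradiction (trans (sym (incSteps-[] c)) run) λ ()
countdown-bumpAt-zero (a ∷ as) {c} {c′} {y} {y′} {ys} run run′ = c′≡ , y′≡
  where
  c′≡ : c′ ≡ c + 2
  c′≡ = countdown-shift {c = c} {d = 2} {x = a} refl run run′
  -- two more increments take the bumped head 1 back to -1, passing a carry to a_1
  two-more : incSteps (2 + c) (bumpAt 0 (a ∷ as)) ≡ -[1+ 0 ] ∷ (y ℤ.+ + 1) ∷ grayStep (isOdd (y ℤ.+ + 1)) ys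
  two-more = begin
    incStep (incStep (incSteps c (bumpAt 0 (a ∷ as))))   ≡⟨ cong (incStep ∘ incStep) (incSteps-bumpAt 0 c (a ∷ as)) ⟩
    incStep (incStep (bumpAt 0 (incSteps c (a ∷ as))))   ≡⟨ cong (incStep ∘ incStep ∘ bumpAt 0) run ⟩
    -[1+ 0 ] ∷ bumpAfterFirstOdd ((y ℤ.+ + 1) ∷ ys)       ≡⟨ cong (-[1+ 0 ] ∷_) (bumpAfterFirstOdd-∷ (y ℤ.+ + 1) ys) ⟩
    -[1+ 0 ] ∷ (y ℤ.+ + 1) ∷ grayStep (isOdd (y ℤ.+ + 1)) ys ∎
    where open ≡-Reasoning
  y′≡ : y′ ≡ y ℤ.+ + 1
  y′≡ = ∷-injectiveˡ (∷-injectiveʳ (begin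
    -[1+ 0 ] ∷ y′ ∷ _                      ≡⟨ run′ ⟨
    incSteps c′ (bumpAt 0 (a ∷ as))        ≡⟨ cong (λ n → incSteps n (bumpAt 0 (a ∷ as))) (trans c′≡ (ℕₚ.+-comm c 2)) ⟩
    incSteps (2 + c) (bumpAt 0 (a ∷ as))   ≡⟨ two-more ⟩
    -[1+ 0 ] ∷ (y ℤ.+ + 1) ∷ _             ∎))
    where open ≡-Reasoning

countdown-bumpAt-suc : ∀ i A {c c′ w w′} →
  incSteps c A ≡ -[1+ 0 ] ∷ w → incSteps c′ (bumpAt (suc i) A) ≡ -[1+ 0 ] ∷ w′ →
  c′ ≡ c × w′ ≡ bumpAt i w
countdown-bumpAt-suc i []       {c} run _ = contradiction (trans (sym (incSteps-[] c)) run) λ ()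
countdown-bumpAt-suc i (a ∷ as) {c} {c′} {w} {w′} run run′ = c′≡ , w′≡
  where
  c′≡ : c′ ≡ c
  c′≡ = trans (countdown-shift {c = c} {d = 0} {x = a} (sym (ℤₚ.+-identityʳ a)) run run′) (ℕₚ.+-identityʳ c)
  w′≡ : w′ ≡ bumpAt i w
  w′≡ = ∷-injectiveʳ (begin
    -[1+ 0 ] ∷ w′                             ≡⟨ run′ ⟨
    incSteps c′ (bumpAt (suc i) (a ∷ as))     ≡⟨ cong (λ n → incSteps n (bumpAt (suc i) (a ∷ as))) c′≡ ⟩
    incSteps c (bumpAt (suc i) (a ∷ as))      ≡⟨ incSteps-bumpAt (suc i) c (a ∷ as) ⟩
    bumpAt (suc i) (incSteps c (a ∷ as))      ≡⟨ cong (bumpAt (suc i)) run ⟩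
    -[1+ 0 ] ∷ bumpAt i w                     ∎)
    where open ≡-Reasoning

iterP-suc : ∀ j X {s} → iterP j X ≡ just s → iterP (suc j) X ≡ stepP s
iterP-suc j X eq rewrite eq = refl

ruleAt-just : ∀ j X {s r} → iterP j X ≡ just s → ruleAt j X ≡ just r → rule s ≡ r
ruleAt-just j X eq at rewrite eq = just-injective at

iterP-increments : ∀ c {X J s} → iterP J X ≡ just s →
  (∀ t → J ≤ t → t < c + J → ruleAt t X ≡ just Increment) →
  iterP (c + J) X ≡ just (incSteps c s) × IncrementsFrom s c
iterP-increments zero    reach _   = reach , tt
iterP-increments (suc c) {X} {J} {s} reach inc =
  trans (iterP-suc (c + J) X reached) (step-Increment (incSteps c s) r) , run , r
  where
  previous = iterP-increments c reach (λ t J≤t t< → inc t J≤t (ℕₚ.m<n⇒m<1+n t<))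
  reached = proj₁ previous
  run = proj₂ previous
  r : rule (incSteps c s) ≡ Increment
  r = ruleAt-just (c + J) X reached (inc (c + J) (ℕₚ.m≤n+m J c) (ℕₚ.n<1+n (c + J)))

record Halving (X s : State) (j : ℕ) : Set where
  field
    count      : ℕ
    next       : ℤ
    rest       : List ℤ
    reaches    : incSteps count s ≡ -[1+ 0 ] ∷ next ∷ rest
    increments : IncrementsFrom s count
    before     : iterP j X ≡ just (incSteps count s)
    after      : iterP (suc j) X ≡ just (next ∷ rest)

halving : ∀ {X J s j} → iterP J X ≡ just s → J ≤ j → (∀ t → J ≤ t → t < j → ruleAt t X ≡ just Increment) →
  ruleAt j X ≡ just Halve → Halving X s j
halving {X} {J} {s} {j} reach J≤j inc halve = record
  { count      = c
  ; next       = proj₁ shape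
  ; rest       = proj₁ (proj₂ shape)
  ; reaches    = proj₂ (proj₂ shape)
  ; increments = proj₂ run
  ; before     = before
  ; after      = trans (iterP-suc j X before) (trans (cong stepP (proj₂ (proj₂ shape)))
                   (step-Halve -[1+ 0 ] _ (subst (λ u → rule u ≡ Halve) (proj₂ (proj₂ shape)) halves)))
  }
  where
  c = j ∸ J
  c+J≡j : c + J ≡ j
  c+J≡j = ℕₚ.m∸n+n≡m J≤j
  run = iterP-increments c reach (λ t J≤t t< → inc t J≤t (subst (t <_) c+J≡j t<))
  before : iterP j X ≡ just (incSteps c s)
  before = subst (λ k → iterP k X ≡ just (incSteps c s)) c+J≡j (proj₁ run)
  halves : rule (incSteps c s) ≡ Halve
  halves = ruleAt-just j X before halve
  shape = Halve⇒shape (incSteps c s) halves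

module _ {X s j} (H : Halving X s j) where
  open Halving H

  halving-sAt : sAt X j ≡ nOf (incSteps count s)
  halving-sAt = cong nOfM before

  halving-hAt : hAt X j ≡ sAt X j / 2
  halving-hAt = begin
    nOfM (iterP (suc j) X)            ≡⟨ cong nOfM after ⟩
    nOf (next ∷ rest)                 ≡⟨ nOf-halve -[1+ 0 ] next rest ⟩
    nOf (-[1+ 0 ] ∷ next ∷ rest) / 2  ≡⟨ cong (λ u → nOf u / 2) reaches ⟨
    nOf (incSteps count s) / 2        ≡⟨ cong (_/ 2) halving-sAt ⟨
    sAt X j / 2                       ∎
    where open ≡-Reasoning

  halving-shift : Shift (parity s) count (nOf s) (sAt X j)
  halving-shift = subst (Shift (parity s) count (nOf s)) (sym halving-sAt) (nOf-incSteps s count increments)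

  halving-parity : parity (next ∷ rest) ≡ not (parity s)
  halving-parity = begin
    parity (next ∷ rest)                        ≡⟨ not-involutive _ ⟨
    not (parity (-[1+ 0 ] ∷ next ∷ rest))       ≡⟨ cong (not ∘ parity) reaches ⟨
    not (parity (incSteps count s))             ≡⟨ cong not (parity-incSteps s count increments) ⟩
    not (parity s)                              ∎
    where open ≡-Reasoning

-- Comparing E with E[i]

-- The part of T_E up to the second Halve rule, for E weakly embanked.
record Trajectory (X : State) (j₁ j₂ : ℕ) : Set where
  field
    first         : Halving X (zeroStep X) j₁
    second        : Halving X (Halving.next first ∷ Halving.rest first) j₂
    zeroStep-even : parity (zeroStep X) ≡ false

weaklyEmbanked⇒trajectory : ∀ X {j₁ j₂} → WeaklyEmbankedAt X j₁ j₂ → Trajectory X j₁ j₂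
weaklyEmbanked⇒trajectory X (_ , zero-rule , 0<j₁ , j₁<j₂ , _ , halve₁ , halve₂ , inc) = record
  { first         = first
  ; second        = halving (Halving.after first) j₁<j₂
                      (λ t j₁<t t<j₂ → inc t (ℕₚ.≤-<-trans z≤n j₁<t) t<j₂ (ℕₚ.>⇒≢ j₁<t)) halve₂
  ; zeroStep-even = parity-zeroStep X (Zero⇒allEven X zeroes)
  }
  where
  zeroes : rule X ≡ Zero
  zeroes = just-injective zero-rule
  first = halving (step-Zero X zeroes) 0<j₁ (λ t 0<t t<j₁ → inc t 0<t (ℕₚ.<-trans t<j₁ j₁<j₂) (ℕₚ.<⇒≢ t<j₁)) halve₁

-- N = n(P(E)), c₁ and c₂ count the Increment rules before the two Halve
-- rules, and s₁ h₁ s₂ h₂ are the values of s and h at them.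
record Profile (N c₁ c₂ s₁ h₁ s₂ h₂ : ℕ) : Set where
  field
    first-count  : c₁ + s₁ ≡ N
    first-half   : h₁ ≡ s₁ / 2
    second-count : s₂ ≡ c₂ + h₁
    second-half  : h₂ ≡ s₂ / 2

trajectory-profile : ∀ {X j₁ j₂} (T : Trajectory X j₁ j₂) → let open Trajectory T in
  Profile (nOf (zeroStep X)) (Halving.count first) (Halving.count second) (sAt X j₁) (hAt X j₁) (sAt X j₂) (hAt X j₂)
trajectory-profile {X} {j₁} {j₂} T = record
  { first-count  = subst (λ b → Shift b (count first) (nOf (zeroStep X)) (sAt X j₁)) zeroStep-even (halving-shift first)
  ; first-half   = halving-hAt first
  ; second-count = trans (subst (λ b → Shift b (count second) (nOf (next first ∷ rest first)) (sAt X j₂)) up (halving-shift second))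
                         (cong (λ h → count second + nOfM h) (sym (after first)))
  ; second-half  = halving-hAt second
  }
  where
  open Trajectory T
  open Halving
  up : parity (next first ∷ rest first) ≡ true
  up = trans (halving-parity first) (cong not zeroStep-even)

module _ {N c₁ c₂ s₁ h₁ s₂ h₂ c₁′ c₂′ s₁′ h₁′ s₂′ h₂′ : ℕ}
         (P : Profile N c₁ c₂ s₁ h₁ s₂ h₂) (P′ : Profile N c₁′ c₂′ s₁′ h₁′ s₂′ h₂′) where
  open Profile

  profile-first : c₁′ ≡ c₁ → s₁′ ≡ s₁ × h₁′ ≡ h₁
  profile-first refl = s₁′≡ , trans (first-half P′) (trans (cong (_/ 2) s₁′≡) (sym (first-half P)))
    where
    s₁′≡ = ℕₚ.+-cancelˡ-≡ c₁ s₁′ s₁ (trans (first-count P′) (sym (first-count P)))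

  profile-unique : c₁′ ≡ c₁ → c₂′ ≡ c₂ → h₁′ ≡ h₁ × h₂′ ≡ h₂ × s₁′ ≡ s₁ × s₂′ ≡ s₂
  profile-unique c₁′≡ refl = h₁′≡ , trans (second-half P′) (trans (cong (_/ 2) s₂′≡) (sym (second-half P))) , s₁′≡ , s₂′≡
    where
    s₁′≡ = proj₁ (profile-first c₁′≡)
    h₁′≡ = proj₂ (profile-first c₁′≡)
    s₂′≡ = trans (second-count P′) (trans (cong (λ h → c₂ + h) h₁′≡) (sym (second-count P)))

  profile-bumpAt-one : c₁′ ≡ c₁ → c₂′ ≡ c₂ + 2 → h₁′ ≡ h₁ × h₂′ ≡ h₂ + 1 × s₁′ ≡ s₁ × s₂′ ≡ s₂ + 2
  profile-bumpAt-one c₁′≡ refl = h₁′≡ , h₂′≡ , s₁′≡ , s₂′≡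
    where
    s₁′≡ = proj₁ (profile-first c₁′≡)
    h₁′≡ = proj₂ (profile-first c₁′≡)
    s₂′≡ : s₂′ ≡ s₂ + 2
    s₂′≡ = begin
      s₂′             ≡⟨ second-count P′ ⟩
      c₂ + 2 + h₁′    ≡⟨ ℕ+.xy∙z≈xz∙y c₂ 2 h₁′ ⟩
      c₂ + h₁′ + 2    ≡⟨ cong (λ h → c₂ + h + 2) h₁′≡ ⟩
      c₂ + h₁ + 2     ≡⟨ cong (_+ 2) (second-count P) ⟨
      s₂ + 2          ∎
      where open ≡-Reasoning
    h₂′≡ : h₂′ ≡ h₂ + 1
    h₂′≡ = trans (second-half P′) (trans (cong (_/ 2) s₂′≡) (trans ([r+q*2]/2≡r/2+q s₂ 1) (cong (_+ 1) (sym (second-half P)))))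

  profile-bumpAt-zero : c₁′ ≡ c₁ + 2 → c₂′ ≡ c₂ + 1 → h₁ ≡ 1 + h₁′ × h₂′ ≡ h₂ × s₁ ≡ 2 + s₁′ × s₂′ ≡ s₂
  profile-bumpAt-zero refl refl = h₁≡ , trans (second-half P′) (trans (cong (_/ 2) s₂′≡) (sym (second-half P))) , s₁≡ , s₂′≡
    where
    s₁≡ : s₁ ≡ 2 + s₁′
    s₁≡ = ℕₚ.+-cancelˡ-≡ c₁ s₁ (2 + s₁′) (trans (first-count P) (trans (sym (first-count P′)) (ℕₚ.+-assoc c₁ 2 s₁′)))
    h₁≡ : h₁ ≡ 1 + h₁′
    h₁≡ = begin
      h₁                     ≡⟨ first-half P ⟩
      s₁ / 2                 ≡⟨ cong (_/ 2) s₁≡ ⟩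
      (2 + s₁′) / 2          ≡⟨ m/n≡1+[m∸n]/n (ℕₚ.m≤m+n 2 s₁′) ⟩
      1 + s₁′ / 2            ≡⟨ cong suc (first-half P′) ⟨
      1 + h₁′                ∎
      where open ≡-Reasoning
    s₂′≡ : s₂′ ≡ s₂
    s₂′≡ = begin
      s₂′                    ≡⟨ second-count P′ ⟩
      c₂ + 1 + h₁′           ≡⟨ ℕₚ.+-assoc c₂ 1 h₁′ ⟩
      c₂ + (1 + h₁′)         ≡⟨ cong (λ h → c₂ + h) h₁≡ ⟨
      c₂ + h₁                ≡⟨ second-count P ⟨
      s₂                     ∎
      where open ≡-Reasoning

+n≡+m-+k : ∀ {m n} k → m ≡ k + n → + n ≡ + m - + k
+n≡+m-+k {n = n} k refl =
  sym (trans (ℤₚ.m-n≡m⊖n (k + n) k) (trans (ℤₚ.⊖-≥ (ℕₚ.m≤m+n k n)) (cong +_ (ℕₚ.m+n∸m≡n k n))))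

bumped-profile : ∀ {E i j₁′ j₂′} (T′ : Trajectory (bumpAt i E) j₁′ j₂′) → zeroStep (bumpAt i E) ≡ bumpAt i (zeroStep E) →
  let open Trajectory T′ in
  Profile (nOf (zeroStep E)) (Halving.count first) (Halving.count second)
          (sAt (bumpAt i E) j₁′) (hAt (bumpAt i E) j₁′) (sAt (bumpAt i E) j₂′) (hAt (bumpAt i E) j₂′)
bumped-profile {E} {i} {j₁′} {j₂′} T′ commutes =
  subst (λ N → Profile N (count first) (count second) (sAt F j₁′) (hAt F j₁′) (sAt F j₂′) (hAt F j₂′))
        (trans (cong nOf commutes) (nOf-bumpAt i (zeroStep E))) (trajectory-profile T′)
  where
  open Trajectory T′
  open Halving
  F = bumpAt i E

bumped-first-run : ∀ {E i j₁′ j₂′} (T′ : Trajectory (bumpAt i E) j₁′ j₂′) → zeroStep (bumpAt i E) ≡ bumpAt i (zeroStep E) →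
  let open Halving (Trajectory.first T′) in incSteps count (bumpAt i (zeroStep E)) ≡ -[1+ 0 ] ∷ next ∷ rest
bumped-first-run T′ commutes = subst (λ A → incSteps count A ≡ -[1+ 0 ] ∷ next ∷ rest) commutes reaches
  where open Halving (Trajectory.first T′)


hs-bumpAt-zero : ∀ {E j₁ j₂ j₁′ j₂′} (T : Trajectory E j₁ j₂) (T′ : Trajectory (bumpAt 0 E) j₁′ j₂′) →
  zeroStep (bumpAt 0 E) ≡ bumpAt 0 (zeroStep E) →
  (+ hAt (bumpAt 0 E) j₁′ ≡ + hAt E j₁ - + 1) × (hAt (bumpAt 0 E) j₂′ ≡ hAt E j₂) ×
  (+ sAt (bumpAt 0 E) j₁′ ≡ + sAt E j₁ - + 2) × (sAt (bumpAt 0 E) j₂′ ≡ sAt E j₂)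
hs-bumpAt-zero {E} T T′ commutes =
  let c₁′≡ , y′≡ = countdown-bumpAt-zero (zeroStep E) (reaches (first T)) (bumped-first-run T′ commutes)
      c₂′≡ = countdown-shift {x = next (first T)} y′≡ (reaches (second T)) (reaches (second T′))
      h₁≡ , h₂′≡ , s₁≡ , s₂′≡ = profile-bumpAt-zero (trajectory-profile T) (bumped-profile T′ commutes) c₁′≡ c₂′≡
  in +n≡+m-+k 1 h₁≡ , h₂′≡ , +n≡+m-+k 2 s₁≡ , s₂′≡
  where
  open Trajectory
  open Halving

hs-bumpAt-one : ∀ {E j₁ j₂ j₁′ j₂′} (T : Trajectory E j₁ j₂) (T′ : Trajectory (bumpAt 1 E) j₁′ j₂′) →
  zeroStep (bumpAt 1 E) ≡ bumpAt 1 (zeroStep E) →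
  (hAt (bumpAt 1 E) j₁′ ≡ hAt E j₁) × (hAt (bumpAt 1 E) j₂′ ≡ hAt E j₂ + 1) ×
  (sAt (bumpAt 1 E) j₁′ ≡ sAt E j₁) × (sAt (bumpAt 1 E) j₂′ ≡ sAt E j₂ + 2)
hs-bumpAt-one {E} T T′ commutes =
  let c₁′≡ , w′≡ = countdown-bumpAt-suc 0 (zeroStep E) (reaches (first T)) (bumped-first-run T′ commutes)
      c₂′≡ = countdown-shift {x = next (first T)} (∷-injectiveˡ w′≡) (reaches (second T)) (reaches (second T′))
  in profile-bumpAt-one (trajectory-profile T) (bumped-profile T′ commutes) c₁′≡ c₂′≡
  where
  open Trajectory
  open Halving

hs-bumpAt-high : ∀ {E i j₁ j₂ j₁′ j₂′} (T : Trajectory E j₁ j₂) (T′ : Trajectory (bumpAt (2 + i) E) j₁′ j₂′) →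
  zeroStep (bumpAt (2 + i) E) ≡ bumpAt (2 + i) (zeroStep E) →
  (hAt (bumpAt (2 + i) E) j₁′ ≡ hAt E j₁) × (hAt (bumpAt (2 + i) E) j₂′ ≡ hAt E j₂) ×
  (sAt (bumpAt (2 + i) E) j₁′ ≡ sAt E j₁) × (sAt (bumpAt (2 + i) E) j₂′ ≡ sAt E j₂)
hs-bumpAt-high {E} {i} T T′ commutes =
  let c₁′≡ , w′≡ = countdown-bumpAt-suc (suc i) (zeroStep E) (reaches (first T)) (bumped-first-run T′ commutes)
      c₂′≡ = countdown-shift {d = 0} {x = next (first T)} (trans (∷-injectiveˡ w′≡) (sym (ℤₚ.+-identityʳ _)))
               (reaches (second T)) (reaches (second T′))
  in profile-unique (trajectory-profile T) (bumped-profile T′ commutes) c₁′≡ (trans c₂′≡ (ℕₚ.+-identityʳ _))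
  where
  open Trajectory
  open Halving

lemma3p5 : (k : ℕ) → 1 ≤ k → (E : State) → (i : ℕ) →
    Sk k ↦ E → ¬ (Sk (suc k) ↦ E) →
    Sk k ↦ bumpAt i E → ¬ (Sk (suc k) ↦ bumpAt i E) →
    Embanked E → i ≤ ellOf E →
    (j₁ j₂ j₁′ j₂′ : ℕ) →
    WeaklyEmbankedAt E j₁ j₂ → WeaklyEmbankedAt (bumpAt i E) j₁′ j₂′ →
    (i ≡ 0 →
      (+ hAt (bumpAt i E) j₁′ ≡ + hAt E j₁ - + 1) × (hAt (bumpAt i E) j₂′ ≡ hAt E j₂) ×
      (+ sAt (bumpAt i E) j₁′ ≡ + sAt E j₁ - + 2) × (sAt (bumpAt i E) j₂′ ≡ sAt E j₂)) ×
    (i ≡ 1 →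
      (hAt (bumpAt i E) j₁′ ≡ hAt E j₁) × (hAt (bumpAt i E) j₂′ ≡ hAt E j₂ + 1) ×
      (sAt (bumpAt i E) j₁′ ≡ sAt E j₁) × (sAt (bumpAt i E) j₂′ ≡ sAt E j₂ + 2)) ×
    (2 ≤ i →
      (hAt (bumpAt i E) j₁′ ≡ hAt E j₁) × (hAt (bumpAt i E) j₂′ ≡ hAt E j₂) ×
      (sAt (bumpAt i E) j₁′ ≡ sAt E j₁) × (sAt (bumpAt i E) j₂′ ≡ sAt E j₂))
lemma3p5 _ _ []       _ _ _ _ _ _ _   _ _ _ _ (_ , () , _) _
lemma3p5 _ _ (x ∷ xs) i _ _ _ _ _ i≤ℓ _ _ _ _ W W′ =
    (λ { refl → hs-bumpAt-zero T T′ commutes })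
  , (λ { refl → hs-bumpAt-one T T′ commutes })
  , (λ { (s≤s (s≤s _)) → hs-bumpAt-high T T′ commutes })
  where
  T  = weaklyEmbanked⇒trajectory (x ∷ xs) W
  T′ = weaklyEmbanked⇒trajectory (bumpAt i (x ∷ xs)) W′
  commutes = zeroStep-bumpAt i x xs i≤ℓ
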